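{- Let $\mathbb{V}=U\oplus W$ be an $n$-dimensional vector space over a finite field $\mathcal{F}$ with $q$ elements, where $U$ and $W$ are nonzero subspaces, and let $\Gamma=\Gamma_{U\oplus W}(\mathbb{V})$ be the direct sum graph. Then: (i) If $n=2$, $\dim(W)=n-1$ and $q=2$, then $\Gamma$ is a trivial graph (a single vertex). (ii) If $n=2$, $\dim(W)=n-1$ and $q\neq 2$, then $\Gamma$ is triangulated. (iii) If $n=3$, $\dim(W)=n-1$ and $q=2$, then $\Gamma$ contains no cycle. (iv) If $n=3$, $\dim(W)=n-1$ and $q\neq 2$, then $\Gamma$ is triangulated. (v) If $n\geq 4$, $\dim(W)=n-1$ and $q\geq 2$, then $\Gamma$ is triangulated. (vi) If $n\geq 4$, $\dim(W)\leq n-2$ and $q\geq 2$, then $\Gamma$ is triangulated.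
   Context: Let $\dim U=r$, $\dim W=s$, $r+s=n$. Fix a basis $\{\alpha_1,\dots,\alpha_r\}$ of $U$ and a basis $\{\beta_1,\dots,\beta_s\}$ of $W$; every $x\in\mathbb{V}$ is written uniquely as $x=\sum_i a_i\alpha_i+\sum_j b_j\beta_j$. The direct sum graph $\Gamma_{U\oplus W}(\mathbb{V})$ is the simple graph whose vertex set is $\{x=u+w: u\in U, w\in W, u\neq 0, w\neq 0\}$, in which two distinct vertices $x,y$ are adjacent iff there is an index $i$ such that the coefficient of $\alpha_i$ is nonzero in both $x$ and $y$, and there is an index $j$ such that the coefficient of $\beta_j$ is nonzero in both $x$ and $y$. A graph is triangulated if every vertex lies in a triangle, i.e. for every vertex $u$ there exist vertices $v,w$ with $u,v,w$ pairwise adjacent. -}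

module Defs where

open import Level using (Level; _⊔_)
open import Data.Nat using (ℕ; zero; suc)
open import Data.Fin using (Fin; suc; inject₁; fromℕ)
import Data.Fin as Fin
open import Data.Product using (Σ; ∃; ∃-syntax; _×_; _,_)
open import Relation.Nullary using (¬_)
open import Relation.Binary.PropositionalEquality using (_≡_)
import Relation.Binary.PropositionalEquality as ≡
open import Algebra.Bundles using (CommutativeRing)
open import Function.Bundles using (Inverse)

record IsField {c ℓ : Level} (F : CommutativeRing c ℓ) : Set (c ⊔ ℓ) where
  open CommutativeRing F using (Carrier; _≈_; _*_; 0#; 1#)
  field
    0≉1 : ¬ (0# ≈ 1#)
    inverse : ∀ x → ¬ (x ≈ 0#) → ∃[ y ] (x * y ≈ 1#)

HasCard : {c ℓ : Level} → CommutativeRing c ℓ → ℕ → Set (c ⊔ ℓ)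
HasCard F q = Inverse (≡.setoid (Fin q)) (CommutativeRing.setoid F)

module DirectSumGraph {c ℓ : Level} (F : CommutativeRing c ℓ) (r s : ℕ) where
  open CommutativeRing F using (Carrier; _≈_; _*_; 0#; 1#)

  -- x = Σ a_i α_i + Σ b_j β_j with u = Σ a_i α_i ≠ 0 and w = Σ b_j β_j ≠ 0
  -- (coordinates in the fixed bases {α_1..α_r} of U and {β_1..β_s} of W).
  record Vertex : Set (c ⊔ ℓ) where
    field
      a : Fin r → Carrier
      b : Fin s → Carrier
      u≢0 : ∃[ i ] ¬ (a i ≈ 0#)
      w≢0 : ∃[ j ] ¬ (b j ≈ 0#)
  open Vertex public

  _≈V_ : Vertex → Vertex → Set ℓ
  x ≈V y = (∀ i → a x i ≈ a y i) × (∀ j → b x j ≈ b y j)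

  Adj : Vertex → Vertex → Set ℓ
  Adj x y = ¬ (x ≈V y)
          × (∃[ i ] (¬ (a x i ≈ 0#) × ¬ (a y i ≈ 0#)))
          × (∃[ j ] (¬ (b x j ≈ 0#) × ¬ (b y j ≈ 0#)))

  Trivial : Set (c ⊔ ℓ)
  Trivial = ∃[ v ] (∀ x → x ≈V v)

  Triangulated : Set (c ⊔ ℓ)
  Triangulated = ∀ u → ∃[ v ] ∃[ w ] (Adj u v × Adj v w × Adj u w)

  -- a cycle of length m + 3: pairwise distinct vertices v_0, ..., v_{m+2}
  -- with v_i ~ v_{i+1} and v_{m+2} ~ v_0
  record Cycle (m : ℕ) : Set (c ⊔ ℓ) where
    field
      vtx : Fin (suc (suc (suc m))) → Vertex
      distinct : ∀ i j → ¬ (i ≡ j) → ¬ (vtx i ≈V vtx j)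
      step : ∀ (i : Fin (suc (suc m))) → Adj (vtx (inject₁ i)) (vtx (suc i))
      close : Adj (vtx (fromℕ (suc (suc m)))) (vtx Fin.zero)

  Acyclic : Set (c ⊔ ℓ)
  Acyclic = ∀ m → ¬ Cycle m

-- Every vertex u has a nonzero α-coordinate i and a nonzero β-coordinate j, and any two
-- distinct vertices that are nonzero at both i and j are adjacent. Changing u in one
-- coordinate P, and separately in a coordinate P' ≠ P, without killing coordinates i and j
-- yields vertices v and w forming a triangle with u. If q ≥ 3 the i-th and j-th coordinates
-- can be replaced by new nonzero values; if n ≥ 4 two coordinates other than i and j can be
-- changed arbitrarily. If q = 2 and dim U = 1, the U-part of every vertex is α₁; for n = 2
-- this leaves a single vertex, and for n = 3 every edge contains α₁ + β₁ + β₂, so the graph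
-- is a star.
{-# OPTIONS --safe #-}
module Submission where

open import Defs
open import Level using (Level)
open import Data.Nat using (ℕ; zero; suc; _+_; _∸_; _≤_; s≤s)
open import Data.Nat.Properties using (+-cancelʳ-≡)
open import Data.Fin using (Fin; zero; suc; fromℕ; punchIn)
open import Data.Fin.Properties using (_≟_; punchInᵢ≢i)
open import Data.Sum using (_⊎_; inj₁; inj₂; [_,_])
import Data.Sum as Sum
open import Data.Sum.Properties using (inj₁-injective; inj₂-injective; ≡-dec)
open import Data.Product using (_×_; _,_; proj₁; proj₂; ∃-syntax; ∃₂; uncurry)
open import Data.Empty using (⊥-elim)
open import Function using (_∘_; const; id)
open import Function.Bundles using (Inverse; Injection)
open import Function.Properties.Inverse using (Inverse⇒Injection) renaming (sym to Inverse-sym)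
open import Relation.Nullary using (¬_; yes; no)
open import Relation.Nullary.Decidable using (via-injection)
open import Relation.Binary.Definitions using (Decidable; DecidableEquality)
open import Relation.Binary.PropositionalEquality
  using (_≡_; _≢_; refl; cong; subst; subst₂; ≢-sym)
  renaming (sym to ≡-sym; trans to ≡-trans)
import Relation.Binary.PropositionalEquality as ≡
open import Algebra.Bundles using (CommutativeRing)

fresh₁ : ∀ {k} (x : Fin (2 + k)) → ∃[ t ] t ≢ x
fresh₁ x = punchIn x zero , punchInᵢ≢i x zero

fresh₂ : ∀ {k} (x y : Fin (3 + k)) → ∃[ t ] (t ≢ x × t ≢ y)
fresh₂ zero          zero          = suc zero , (λ ()) , (λ ())
fresh₂ zero          (suc zero)    = suc (suc zero) , (λ ()) , (λ ())
fresh₂ zero          (suc (suc _)) = suc zero , (λ ()) , (λ ())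
fresh₂ (suc zero)    zero          = suc (suc zero) , (λ ()) , (λ ())
fresh₂ (suc (suc _)) zero          = suc zero , (λ ()) , (λ ())
fresh₂ (suc _)       (suc _)       = zero , (λ ()) , (λ ())

fresh-if-≢2 : ∀ {n} → n ≢ 2 → (x y : Fin n) → x ≢ y → ∃[ t ] (t ≢ x × t ≢ y)
fresh-if-≢2 {1}                 _   zero zero x≢y = ⊥-elim (x≢y refl)
fresh-if-≢2 {2}                 n≢2 _    _    _   = ⊥-elim (n≢2 refl)
fresh-if-≢2 {suc (suc (suc _))} _   x    y    _   = fresh₂ x y

cover₂ : (t x y : Fin 2) → x ≢ y → t ≡ x ⊎ t ≡ y
cover₂ zero       zero       _          _   = inj₁ refl
cover₂ zero       (suc zero) zero       _   = inj₂ refl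
cover₂ (suc zero) (suc zero) _          _   = inj₁ refl
cover₂ (suc zero) zero       (suc zero) _   = inj₂ refl
cover₂ _          zero       zero       x≢y = ⊥-elim (x≢y refl)
cover₂ _          (suc zero) (suc zero) x≢y = ⊥-elim (x≢y refl)

elim₂ : ∀ {p} {P : Fin 2 → Set p} {x y} → x ≢ y → P x → P y → ∀ t → P t
elim₂ {x = x} {y} x≢y px py t with cover₂ t x y x≢y
... | inj₁ refl = px
... | inj₂ refl = py

Anchor : ∀ {r s} → Fin r → Fin s → Fin r ⊎ Fin s → Set
Anchor i j P = P ≡ inj₁ i ⊎ P ≡ inj₂ j

spare-positions : ∀ {r s} (i : Fin r) (j : Fin s) → 4 ≤ r + s →
  ∃₂ λ P P' → P ≢ P' × ¬ Anchor i j P × ¬ Anchor i j P'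
spare-positions {suc (suc (suc _))} i j _ =
  let t , t≢i = fresh₁ i
      t' , t'≢i , t'≢t = fresh₂ i t
  in inj₁ t , inj₁ t' , ≢-sym t'≢t ∘ inj₁-injective , α-spare t≢i , α-spare t'≢i
  where
    α-spare : ∀ {t} → t ≢ i → ¬ Anchor i j (inj₁ t)
    α-spare t≢i = [ t≢i ∘ inj₁-injective , (λ ()) ]
spare-positions {1} {suc (suc (suc _))} i j _ =
  let t , t≢j = fresh₁ j
      t' , t'≢j , t'≢t = fresh₂ j t
  in inj₂ t , inj₂ t' , ≢-sym t'≢t ∘ inj₂-injective , β-spare t≢j , β-spare t'≢j
  where
    β-spare : ∀ {t} → t ≢ j → ¬ Anchor i j (inj₂ t)
    β-spare t≢j = [ (λ ()) , t≢j ∘ inj₂-injective ]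
spare-positions {2} {suc (suc _)} i j _ =
  let t , t≢i = fresh₁ i
      t' , t'≢j = fresh₁ j
  in inj₁ t , inj₂ t' , (λ ()) , [ t≢i ∘ inj₁-injective , (λ ()) ]
                                , [ (λ ()) , t'≢j ∘ inj₂-injective ]
spare-positions {1} {1} _ _ (s≤s (s≤s ()))
spare-positions {1} {2} _ _ (s≤s (s≤s (s≤s ())))
spare-positions {2} {1} _ _ (s≤s (s≤s (s≤s ())))

unit-codimension : ∀ {r s m} → r + s ≡ suc m → s ≡ m → r ≡ 1
unit-codimension {r} {m = m} r+s≡1+m refl = +-cancelʳ-≡ m r 1 r+s≡1+m

module _ {c ℓ : Level} (F : CommutativeRing c ℓ) where
  open CommutativeRing F using (Carrier; _≈_; 0#; 1#; setoid; sym; trans)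

  module Vertices (r s : ℕ) where
    open DirectSumGraph F r s

    Position : Set
    Position = Fin r ⊎ Fin s

    _≟ₚ_ : DecidableEquality Position
    _≟ₚ_ = ≡-dec _≟_ _≟_

    coord : Vertex → Position → Carrier
    coord x (inj₁ i) = a x i
    coord x (inj₂ j) = b x j

    ≉-at : ∀ {x y} P → ¬ coord x P ≈ coord y P → ¬ x ≈V y
    ≉-at (inj₁ i) ≉ (a≈ , _) = ≉ (a≈ i)
    ≉-at (inj₂ j) ≉ (_ , b≈) = ≉ (b≈ j)

    acyclic-if-star : ∀ {p} (Hub : Vertex → Set p) →
      (∀ x y → Hub x → Hub y → x ≈V y) → (∀ x y → Adj x y → Hub x ⊎ Hub y) → Acyclic
    acyclic-if-star Hub unique meets m C = [ no-hub-v₀ , no-hub-v₁ ] (meets v₀ v₁ (step zero))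
      where
        open Cycle C
        v₀ v₁ v₂ vₗ : Vertex
        v₀ = vtx zero
        v₁ = vtx (suc zero)
        v₂ = vtx (suc (suc zero))
        vₗ = vtx (fromℕ (suc (suc m)))

        no-hub-v₀ : ¬ Hub v₀
        no-hub-v₀ hub₀ =
          [ (λ hub₁ → proj₁ (step zero) (unique v₀ v₁ hub₀ hub₁))
          , (λ hub₂ → distinct zero (suc (suc zero)) (λ ()) (unique v₀ v₂ hub₀ hub₂))
          ] (meets v₁ v₂ (step (suc zero)))

        no-hub-v₁ : ¬ Hub v₁
        no-hub-v₁ hub₁ =
          [ (λ hubₗ → distinct (suc zero) (fromℕ (suc (suc m))) (λ ()) (unique v₁ vₗ hub₁ hubₗ))
          , no-hub-v₀
          ] (meets vₗ v₀ close)

    module Triangle (u : Vertex) where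
      i : Fin r
      i = proj₁ (u≢0 u)

      j : Fin s
      j = proj₁ (w≢0 u)

      anchor-≉0 : ∀ {Q} → Anchor i j Q → ¬ coord u Q ≈ 0#
      anchor-≉0 (inj₁ refl) = proj₂ (u≢0 u)
      anchor-≉0 (inj₂ refl) = proj₂ (w≢0 u)

      Keeps : Position → Carrier → Set ℓ
      Keeps P c = Anchor i j P → ¬ c ≈ 0#

      update : Position → Carrier → Position → Carrier
      update P c Q with P ≟ₚ Q
      ... | yes _ = c
      ... | no  _ = coord u Q

      update-same : ∀ P c → update P c P ≡ c
      update-same P c with P ≟ₚ P
      ... | yes _   = refl
      ... | no  P≢P = ⊥-elim (P≢P refl)

      update-other : ∀ {P Q} c → P ≢ Q → update P c Q ≡ coord u Q
      update-other {P} {Q} c P≢Q with P ≟ₚ Q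
      ... | yes P≡Q = ⊥-elim (P≢Q P≡Q)
      ... | no  _   = refl

      update-≉0 : ∀ {P c Q} → Keeps P c → Anchor i j Q → ¬ update P c Q ≈ 0#
      update-≉0 {P} {c} {Q} keeps anchor with P ≟ₚ Q
      ... | yes refl = keeps anchor
      ... | no  _    = anchor-≉0 anchor

      edit : (P : Position) (c : Carrier) → Keeps P c → Vertex
      edit P c keeps = record
        { a   = λ k → update P c (inj₁ k)
        ; b   = λ k → update P c (inj₂ k)
        ; u≢0 = i , update-≉0 keeps (inj₁ refl)
        ; w≢0 = j , update-≉0 keeps (inj₂ refl)
        }

      coord-edit : ∀ {P c} (keeps : Keeps P c) Q → coord (edit P c keeps) Q ≡ update P c Q
      coord-edit _ (inj₁ _) = refl
      coord-edit _ (inj₂ _) = refl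

      Anchored : Vertex → Set ℓ
      Anchored x = ¬ a x i ≈ 0# × ¬ b x j ≈ 0#

      adjacent : ∀ x y → Anchored x → Anchored y → ¬ x ≈V y → Adj x y
      adjacent _ _ (xi , xj) (yi , yj) x≉y = x≉y , (i , xi , yi) , (j , xj , yj)

      u-anchored : Anchored u
      u-anchored = anchor-≉0 (inj₁ refl) , anchor-≉0 (inj₂ refl)

      edit-anchored : ∀ {P c} (keeps : Keeps P c) → Anchored (edit P c keeps)
      edit-anchored keeps = update-≉0 keeps (inj₁ refl) , update-≉0 keeps (inj₂ refl)

      triangle : ∀ {P P' c c'} (keeps : Keeps P c) (keeps' : Keeps P' c') → P ≢ P' →
        ¬ c ≈ coord u P → ¬ c' ≈ coord u P' → ∃[ v ] ∃[ w ] (Adj u v × Adj v w × Adj u w)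
      triangle {P} {P'} {c} {c'} keeps keeps' P≢P' c≉ c'≉ =
          v , w
        , adjacent u v u-anchored (edit-anchored keeps) u≉v
        , adjacent v w (edit-anchored keeps) (edit-anchored keeps') v≉w
        , adjacent u w u-anchored (edit-anchored keeps') u≉w
        where
          v w : Vertex
          v = edit P c keeps
          w = edit P' c' keeps'

          v-at-P : coord v P ≡ c
          v-at-P = ≡-trans (coord-edit keeps P) (update-same P c)

          w-at-P' : coord w P' ≡ c'
          w-at-P' = ≡-trans (coord-edit keeps' P') (update-same P' c')

          w-at-P : coord w P ≡ coord u P
          w-at-P = ≡-trans (coord-edit keeps' P) (update-other c' (≢-sym P≢P'))

          u≉v : ¬ u ≈V v
          u≉v = ≉-at P (λ u≈v → c≉ (sym (subst (coord u P ≈_) v-at-P u≈v)))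

          u≉w : ¬ u ≈V w
          u≉w = ≉-at P' (λ u≈w → c'≉ (sym (subst (coord u P' ≈_) w-at-P' u≈w)))

          v≉w : ¬ v ≈V w
          v≉w = ≉-at P (c≉ ∘ subst₂ _≈_ v-at-P w-at-P)

  module _ (isField : IsField F) {q : ℕ} (card : HasCard F q) where
    open IsField isField using (0≉1)
    open Inverse card using (to; from-cong; strictlyInverseʳ)

    coordinates : Injection setoid (≡.setoid (Fin q))
    coordinates = Inverse⇒Injection (Inverse-sym card)

    open Injection coordinates using () renaming (to to from; injective to from-injective)

    ≈-dec : Decidable _≈_
    ≈-dec = via-injection coordinates _≟_

    from-≢ : ∀ {x y} → ¬ x ≈ y → from x ≢ from y
    from-≢ x≉y = x≉y ∘ from-injective

    to-≉ : ∀ {t x} → t ≢ from x → ¬ to t ≈ x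
    to-≉ {t} t≢x to-t≈x = t≢x (≡-trans (≡-sym (strictlyInverseʳ t)) (from-cong to-t≈x))

    1≉-if-≈0 : ∀ {x} → x ≈ 0# → ¬ 1# ≈ x
    1≉-if-≈0 x≈0 1≈x = 0≉1 (sym (trans 1≈x x≈0))

    ∃≉ : ∀ x → ∃[ y ] ¬ y ≈ x
    ∃≉ x with ≈-dec x 0#
    ... | yes x≈0 = 1# , 1≉-if-≈0 x≈0
    ... | no  x≉0 = 0# , x≉0 ∘ sym

    ∃≉0-≉ : q ≢ 2 → ∀ x → ∃[ y ] (¬ y ≈ 0# × ¬ y ≈ x)
    ∃≉0-≉ q≢2 x with ≈-dec x 0#
    ... | yes x≈0 = 1# , 0≉1 ∘ sym , 1≉-if-≈0 x≈0
    ... | no  x≉0 =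
      let t , t≢0 , t≢x = fresh-if-≢2 q≢2 (from 0#) (from x) (from-≢ (x≉0 ∘ sym))
      in to t , to-≉ t≢0 , to-≉ t≢x

    ≈0⊎≈1 : q ≡ 2 → ∀ x → x ≈ 0# ⊎ x ≈ 1#
    ≈0⊎≈1 refl x = Sum.map from-injective from-injective (cover₂ (from x) (from 0#) (from 1#) (from-≢ 0≉1))

    ≉0⇒≈1 : q ≡ 2 → ∀ {x} → ¬ x ≈ 0# → x ≈ 1#
    ≉0⇒≈1 q≡2 {x} x≉0 = [ ⊥-elim ∘ x≉0 , id ] (≈0⊎≈1 q≡2 x)

    single-≉0⇒≈1 : q ≡ 2 → (f : Fin 1 → Carrier) → ∃[ k ] ¬ f k ≈ 0# → ∀ k → f k ≈ 1#
    single-≉0⇒≈1 q≡2 f (zero , f0≉0) zero = ≉0⇒≈1 q≡2 f0≉0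

    module _ (r s : ℕ) where
      open DirectSumGraph F r s
      open Vertices r s

      triangulated-if-q≢2 : q ≢ 2 → Triangulated
      triangulated-if-q≢2 q≢2 u =
        let open Triangle u
            c , c≉0 , c≉ = ∃≉0-≉ q≢2 (a u i)
            c' , c'≉0 , c'≉ = ∃≉0-≉ q≢2 (b u j)
        in triangle {inj₁ i} {inj₂ j} (const c≉0) (const c'≉0) (λ ()) c≉ c'≉

      triangulated-if-4≤dim : 4 ≤ r + s → Triangulated
      triangulated-if-4≤dim 4≤r+s u =
        let open Triangle u
            P , P' , P≢P' , P-spare , P'-spare = spare-positions i j 4≤r+s
            c , c≉ = ∃≉ (coord u P)
            c' , c'≉ = ∃≉ (coord u P')
        in triangle (⊥-elim ∘ P-spare) (⊥-elim ∘ P'-spare) P≢P' c≉ c'≉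

    module _ (q≡2 : q ≡ 2) where
      trivial-1⊕1 : DirectSumGraph.Trivial F 1 1
      trivial-1⊕1 = one , λ x → single-≉0⇒≈1 q≡2 (a x) (u≢0 x) , single-≉0⇒≈1 q≡2 (b x) (w≢0 x)
        where
          open DirectSumGraph F 1 1
          one : Vertex
          one = record { a = const 1# ; b = const 1# ; u≢0 = zero , 0≉1 ∘ sym ; w≢0 = zero , 0≉1 ∘ sym }

      acyclic-1⊕2 : DirectSumGraph.Acyclic F 1 2
      acyclic-1⊕2 = acyclic-if-star Hub hubs-equal edge-meets-hub
        where
          open DirectSumGraph F 1 2
          open Vertices 1 2

          Hub : Vertex → Set ℓ
          Hub x = ∀ k → b x k ≈ 1#

          α≈1 : ∀ x k → a x k ≈ 1#
          α≈1 x = single-≉0⇒≈1 q≡2 (a x) (u≢0 x)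

          α-equal : ∀ x y k → a x k ≈ a y k
          α-equal x y k = trans (α≈1 x k) (sym (α≈1 y k))

          hubs-equal : ∀ x y → Hub x → Hub y → x ≈V y
          hubs-equal x y hx hy = α-equal x y , λ k → trans (hx k) (sym (hy k))

          -- Two non-hubs sharing a nonzero β-coordinate both vanish at the other one, hence coincide.
          edge-meets-hub : ∀ x y → Adj x y → Hub x ⊎ Hub y
          edge-meets-hub x y (x≉y , _ , (k , xk≉0 , yk≉0))
            with k' , k'≢k ← fresh₁ k
               | ≈0⊎≈1 q≡2 (b x k') | ≈0⊎≈1 q≡2 (b y k')
          ... | inj₂ x≈1 | _        = inj₁ (elim₂ k'≢k x≈1 (≉0⇒≈1 q≡2 xk≉0))
          ... | inj₁ _   | inj₂ y≈1 = inj₂ (elim₂ k'≢k y≈1 (≉0⇒≈1 q≡2 yk≉0))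
          ... | inj₁ x≈0 | inj₁ y≈0 = ⊥-elim (x≉y (α-equal x y ,
            elim₂ k'≢k (trans x≈0 (sym y≈0)) (trans (≉0⇒≈1 q≡2 xk≉0) (sym (≉0⇒≈1 q≡2 yk≉0)))))

theorem3p5 : {c ℓ : Level} (F : CommutativeRing c ℓ) → IsField F →
  (q : ℕ) → HasCard F q →
  (n r s : ℕ) → 1 ≤ r → 1 ≤ s → r + s ≡ n →
  let open DirectSumGraph F r s in
    (n ≡ 2 → s ≡ n ∸ 1 → q ≡ 2 → Trivial)
  × (n ≡ 2 → s ≡ n ∸ 1 → ¬ (q ≡ 2) → Triangulated)
  × (n ≡ 3 → s ≡ n ∸ 1 → q ≡ 2 → Acyclic)
  × (n ≡ 3 → s ≡ n ∸ 1 → ¬ (q ≡ 2) → Triangulated)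
  × (4 ≤ n → s ≡ n ∸ 1 → 2 ≤ q → Triangulated)
  × (4 ≤ n → s ≤ n ∸ 2 → 2 ≤ q → Triangulated)
theorem3p5 F isField q card n r s _ _ r+s≡n =
    (λ n≡2 s≡n-1 q≡2 → uncurry (subst₂ (DirectSumGraph.Trivial F)) (dims n≡2 s≡n-1)
                                (trivial-1⊕1 F isField card q≡2))
  , (λ _ _ q≢2 → triangulated-if-q≢2 F isField card r s q≢2)
  , (λ n≡3 s≡n-1 q≡2 → uncurry (subst₂ (DirectSumGraph.Acyclic F)) (dims n≡3 s≡n-1)
                                (acyclic-1⊕2 F isField card q≡2))
  , (λ _ _ q≢2 → triangulated-if-q≢2 F isField card r s q≢2)
  , (λ 4≤n _ _ → triangulated-if-4≤dim F isField card r s (4≤r+s 4≤n))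
  , (λ 4≤n _ _ → triangulated-if-4≤dim F isField card r s (4≤r+s 4≤n))
  where
    dims : ∀ {m} → n ≡ suc m → s ≡ n ∸ 1 → 1 ≡ r × m ≡ s
    dims n≡1+m s≡n-1 =
      let s≡m = ≡-trans s≡n-1 (cong (_∸ 1) n≡1+m)
      in ≡-sym (unit-codimension (≡-trans r+s≡n n≡1+m) s≡m) , ≡-sym s≡m

    4≤r+s : 4 ≤ n → 4 ≤ r + s
    4≤r+s = subst (4 ≤_) (≡-sym r+s≡n)
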